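{- For every integer $k\geq1$, \[b_{2,k}(k)=\begin{cases}\frac{k+1}{2} & \text{if } k\equiv1\pmod 2,\\ \frac{k}{2} & \text{if } k\equiv 0\pmod 2,\end{cases}\qquad b_{2,k}(k+1)=\begin{cases}1 & \text{if } k\equiv1\pmod 2,\\ 2 & \text{if } k\equiv 0\pmod 2.\end{cases}\]
   Context: A $2$-regular partition of $n$ is a partition of $n$ with no even parts. The hook length of a box in the Young diagram of a partition (rows of lengths $\lambda_1\geq\lambda_2\geq\cdots$, left-justified) is the number of boxes directly to its right plus the number directly below it plus $1$. For $k\geq1$, $b_{2,k}(n)$ denotes the total number of boxes of hook length $k$, counted over all $2$-regular partitions of $n$. -}

module Defs where

open import Data.Nat using (ℕ; zero; suc; _+_; _∸_; _%_; _≟_; _≤?_; _<?_)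
open import Data.Bool using (Bool; true; _∧_; T?)
open import Data.List using (List; []; _∷_; map; concatMap; filter; length; upTo)
open import Data.Nat.ListAction using (sum)
open import Relation.Nullary.Decidable using (⌊_⌋)

-- A partition is represented as the list of its parts in weakly decreasing
-- order, all parts positive: λ₁ ≥ λ₂ ≥ ⋯ ≥ λ_ℓ ≥ 1.
Partition : Set
Partition = List ℕ

-- The first part is chosen as q ∈ {1,…,min(m,n)}, then the rest is a partition
-- of n - q with parts ≤ q.  'fuel' bounds the number of parts (fuel = n suffices).
boundedPartitions : ℕ → ℕ → ℕ → List Partition
boundedPartitions _ _ zero = [] ∷ []
boundedPartitions zero _ (suc _) = []
boundedPartitions (suc fuel) m (suc n) =
  concatMap (λ q → map (λ rest → q ∷ rest) (boundedPartitions fuel q (suc n ∸ q)))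
            (filter (λ q → q ≤? m) (map suc (upTo (suc n))))

partitions : ℕ → List Partition
partitions n = boundedPartitions n n n

-- A 2-regular partition: no even parts (every part is odd).
noEvenParts : Partition → Bool
noEvenParts [] = true
noEvenParts (x ∷ xs) = ⌊ x % 2 ≟ 1 ⌋ ∧ noEvenParts xs

regular2Partitions : ℕ → List Partition
regular2Partitions n = filter (λ p → T? (noEvenParts p)) (partitions n)

colLength : Partition → ℕ → ℕ
colLength p j = length (filter (λ r → j <? r) p)

-- Hook length of the box in row i, column j (0-indexed) of the Young diagram
-- of p, where row i has length li:  (boxes to the right) + (boxes below) + 1
--   = (li - j - 1) + (λ'_j - i - 1) + 1.
hookLength : Partition → ℕ → ℕ → ℕ → ℕ
hookLength p i li j = (li ∸ suc j) + (colLength p j ∸ suc i) + 1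

countRows : Partition → ℕ → ℕ → List ℕ → ℕ
countRows p k i [] = 0
countRows p k i (li ∷ rest) =
  length (filter (λ j → hookLength p i li j ≟ k) (upTo li)) + countRows p k (suc i) rest

hookCount : ℕ → Partition → ℕ
hookCount k p = countRows p k 0 p

b2 : ℕ → ℕ → ℕ
b2 k n = sum (map (hookCount k) (regular2Partitions n))

-- A box of hook length h in a partition of n has h ≤ n, with equality only for the corner
-- box of a hook (q, 1, …, 1). Splitting the 2-regular partitions of n by their first part q,
-- b_{2,n}(n) is therefore the number of odd q ≤ n. For hook length n − 1 with n ≥ 2 only two
-- boxes qualify: the second box of the column (1, …, 1), and the second box of the single
-- row (n), which counts when n is odd. The corner of a partition into odd parts cannot have
-- hook length n − 1 by parity, and every other box has a shorter hook.

module Submission where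

open import Defs
open import Data.Bool using (Bool; true; false; if_then_else_; _∧_; T?)
open import Data.Bool.Properties using (∧-conicalʳ; ∧-identityʳ)
open import Data.Empty using (⊥-elim)
open import Data.List using (List; []; _∷_; _++_; map; concatMap; filter; length; upTo)
open import Data.List.Properties using (map-++; map-∘; map-upTo; upTo-∷ʳ; filter-accept; length-filter)
open import Data.List.Membership.Propositional using (_∈_)
open import Data.List.Membership.Propositional.Properties using (∈-upTo⁻)
open import Data.List.Relation.Unary.All as All using (All; []; _∷_)
open import Data.List.Relation.Unary.All.Properties using (concat⁺; map⁺; filter⁺; all-filter; applyUpTo⁺₁)
open import Data.List.Relation.Unary.Any using (here; there)
open import Data.Nat using (ℕ; zero; suc; _+_; _*_; _∸_; _%_; _≤_; _<_; _≟_; _≤?_; z≤n; s≤s; z<s)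
open import Data.Nat.DivMod using (m*n%n≡0; [m+kn]%n≡m%n)
open import Data.Nat.ListAction using (sum)
open import Data.Nat.ListAction.Properties using (sum-++)
open import Data.Nat.Properties
open import Data.Nat.Tactic.RingSolver using (solve-∀)
open import Data.Product using (_×_; _,_)
open import Data.Unit using (⊤; tt)
open import Function using (_⇔_; mk⇔)
open import Relation.Nullary using (Dec; yes; no; does)
open import Relation.Nullary.Decidable using (⌊_⌋; dec-true; dec-false; does-⇔)
open import Relation.Binary.PropositionalEquality

private
  variable
    A B : Set

∑ : List A → (A → ℕ) → ℕ
∑ xs f = sum (map f xs)

syntax ∑ xs (λ x → e) = ∑[ x ∈ xs ] e

𝟙 : Bool → ℕ
𝟙 b = if b then 1 else 0

∑-++ : ∀ (f : A → ℕ) xs ys → ∑ (xs ++ ys) f ≡ ∑ xs f + ∑ ys f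
∑-++ f xs ys = trans (cong sum (map-++ f xs ys)) (sum-++ (map f xs) (map f ys))

∑-concatMap : ∀ (f : B → ℕ) (g : A → List B) xs →
              ∑ (concatMap g xs) f ≡ ∑[ x ∈ xs ] ∑ (g x) f
∑-concatMap f g []       = refl
∑-concatMap f g (x ∷ xs) = trans (∑-++ f (g x) _) (cong (∑ (g x) f +_) (∑-concatMap f g xs))

∑-map : ∀ (f : B → ℕ) (h : A → B) xs → ∑ (map h xs) f ≡ ∑[ x ∈ xs ] f (h x)
∑-map f h xs = cong sum (sym (map-∘ xs))

∑-filter : ∀ {P : A → Set} (P? : ∀ x → Dec (P x)) (f : A → ℕ) xs →
           ∑ (filter P? xs) f ≡ ∑[ x ∈ xs ] (if does (P? x) then f x else 0)
∑-filter P? f []       = refl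
∑-filter P? f (x ∷ xs) with does (P? x)
... | true  = cong (f x +_) (∑-filter P? f xs)
... | false = ∑-filter P? f xs

length-filter≡∑ : ∀ {P : A → Set} (P? : ∀ x → Dec (P x)) xs →
                  length (filter P? xs) ≡ ∑[ x ∈ xs ] 𝟙 (does (P? x))
length-filter≡∑ P? []       = refl
length-filter≡∑ P? (x ∷ xs) with does (P? x)
... | true  = cong suc (length-filter≡∑ P? xs)
... | false = length-filter≡∑ P? xs

∑-cong : ∀ xs {f g : A → ℕ} → (∀ {x} → x ∈ xs → f x ≡ g x) → ∑ xs f ≡ ∑ xs g
∑-cong []       f≡g = refl
∑-cong (x ∷ xs) f≡g = cong₂ _+_ (f≡g (here refl)) (∑-cong xs (λ x∈ → f≡g (there x∈)))

∑-zero : ∀ xs {f : A → ℕ} → (∀ {x} → x ∈ xs → f x ≡ 0) → ∑ xs f ≡ 0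
∑-zero []       f≡0 = refl
∑-zero (x ∷ xs) f≡0 = cong₂ _+_ (f≡0 (here refl)) (∑-zero xs (λ x∈ → f≡0 (there x∈)))

∑-if : ∀ b (f : A → ℕ) xs → ∑[ x ∈ xs ] (if b then f x else 0) ≡ (if b then ∑ xs f else 0)
∑-if true  f xs = refl
∑-if false f xs = ∑-zero xs (λ _ → refl)

∑-upTo-suc : ∀ (f : ℕ → ℕ) n → ∑[ j ∈ upTo (suc n) ] f j ≡ f 0 + ∑[ j ∈ upTo n ] f (suc j)
∑-upTo-suc f n = cong (f 0 +_) (trans (cong (λ js → ∑ js f) (sym (map-upTo suc n))) (∑-map f suc (upTo n)))

∑-upTo-∷ʳ : ∀ (f : ℕ → ℕ) n → ∑[ j ∈ upTo (suc n) ] f j ≡ ∑[ j ∈ upTo n ] f j + f n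
∑-upTo-∷ʳ f n = begin
  ∑ (upTo (suc n)) f       ≡⟨ cong (λ js → ∑ js f) (upTo-∷ʳ n) ⟨
  ∑ (upTo n ++ n ∷ []) f   ≡⟨ ∑-++ f (upTo n) (n ∷ []) ⟩
  ∑ (upTo n) f + (f n + 0) ≡⟨ cong (∑ (upTo n) f +_) (+-identityʳ (f n)) ⟩
  ∑ (upTo n) f + f n       ∎
  where open ≡-Reasoning

if≡0 : ∀ b {x} → (b ≡ true → x ≡ 0) → (if b then x else 0) ≡ 0
if≡0 true  x≡0 = x≡0 refl
if≡0 false x≡0 = refl

if-∧-redundant : ∀ {C : Set} a b (c? : Dec C) → (C → b ≡ true) →
  (if a ∧ b then 𝟙 (does c?) else 0) ≡ (if a then 𝟙 (does c?) else 0)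
if-∧-redundant false b     c?      c⇒b = refl
if-∧-redundant true  true  c?      c⇒b = refl
if-∧-redundant true  false (no _)  c⇒b = refl
if-∧-redundant true  false (yes c) c⇒b with () ← c⇒b c

m+n+1≡1+m+o⇔n≡o : ∀ m n o → m + n + 1 ≡ suc m + o ⇔ n ≡ o
m+n+1≡1+m+o⇔n≡o m n o = mk⇔
  (λ eq → +-cancelˡ-≡ m n o (suc-injective (trans (+-comm 1 (m + n)) eq)))
  (λ { refl → +-comm (m + n) 1 })

m+1+n≤o⇒m<o : ∀ m {n o} → m + suc n ≤ o → m < o
m+1+n≤o⇒m<o m {n} {o} le = m+n≤o⇒m≤o (suc m) (subst (_≤ o) (+-suc m n) le)

BoundedPartition : ℕ → Partition → Set
BoundedPartition m []      = ⊤
BoundedPartition m (q ∷ p) = 1 ≤ q × q ≤ m × BoundedPartition q p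

boundedPartitions-sound : ∀ fuel m r →
  All (λ p → BoundedPartition m p × sum p ≡ r) (boundedPartitions fuel m r)
boundedPartitions-sound _          m zero    = (tt , refl) ∷ []
boundedPartitions-sound zero       m (suc n) = []
boundedPartitions-sound (suc fuel) m (suc n) =
  concat⁺ (map⁺ (All.map extend (All.zip (filter⁺ (_≤? m) firstParts , all-filter (_≤? m) (map suc (upTo (suc n)))))))
  where
  firstParts : All (λ q → 1 ≤ q × q ≤ suc n) (map suc (upTo (suc n)))
  firstParts = map⁺ (applyUpTo⁺₁ _ (suc n) (λ j<1+n → s≤s z≤n , j<1+n))
  extend : ∀ {q} → (1 ≤ q × q ≤ suc n) × q ≤ m →
           All (λ p → BoundedPartition m p × sum p ≡ suc n) (map (q ∷_) (boundedPartitions fuel q (suc n ∸ q)))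
  extend {q} ((1≤q , q≤1+n) , q≤m) = map⁺ (All.map
    (λ (bounded , sum≡) → (1≤q , q≤m , bounded) , trans (cong (q +_) sum≡) (m+[n∸m]≡n q≤1+n))
    (boundedPartitions-sound fuel q (suc n ∸ q)))

∑-cong-boundedPartitions : ∀ fuel m r {f g : Partition → ℕ} →
  (∀ {p} → BoundedPartition m p → sum p ≡ r → f p ≡ g p) →
  ∑ (boundedPartitions fuel m r) f ≡ ∑ (boundedPartitions fuel m r) g
∑-cong-boundedPartitions fuel m r f≡g = ∑-cong (boundedPartitions fuel m r) λ p∈ →
  let bounded , sum≡ = All.lookup (boundedPartitions-sound fuel m r) p∈ in f≡g bounded sum≡

∑-boundedPartitions : ∀ (f : Partition → ℕ) fuel m n →
  ∑ (boundedPartitions (suc fuel) m (suc n)) f ≡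
  ∑[ j ∈ upTo (suc n) ]
    (if does (suc j ≤? m) then ∑[ rest ∈ boundedPartitions fuel (suc j) (n ∸ j) ] f (suc j ∷ rest) else 0)
∑-boundedPartitions f fuel m n = begin
  ∑ (concatMap withFirst (filter (_≤? m) (map suc (upTo (suc n))))) f
    ≡⟨ ∑-concatMap f withFirst (filter (_≤? m) (map suc (upTo (suc n)))) ⟩
  ∑[ q ∈ filter (_≤? m) (map suc (upTo (suc n))) ] ∑ (withFirst q) f
    ≡⟨ ∑-filter (_≤? m) (λ q → ∑ (withFirst q) f) (map suc (upTo (suc n))) ⟩
  ∑[ q ∈ map suc (upTo (suc n)) ] (if does (q ≤? m) then ∑ (withFirst q) f else 0)
    ≡⟨ ∑-map (λ q → if does (q ≤? m) then ∑ (withFirst q) f else 0) suc (upTo (suc n)) ⟩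
  ∑[ j ∈ upTo (suc n) ] (if does (suc j ≤? m) then ∑ (withFirst (suc j)) f else 0)
    ≡⟨ ∑-cong (upTo (suc n)) (λ {j} _ → cong (λ s → if does (suc j ≤? m) then s else 0)
                                            (∑-map f (suc j ∷_) (boundedPartitions fuel (suc j) (n ∸ j)))) ⟩
  ∑[ j ∈ upTo (suc n) ]
    (if does (suc j ≤? m) then ∑[ rest ∈ boundedPartitions fuel (suc j) (n ∸ j) ] f (suc j ∷ rest) else 0) ∎
  where
  open ≡-Reasoning
  withFirst : ℕ → List Partition
  withFirst q = map (q ∷_) (boundedPartitions fuel q (suc n ∸ q))

parts≤ : ∀ {q} p → BoundedPartition q p → All (_≤ q) p
parts≤ []      _                   = []
parts≤ (x ∷ p) (_ , x≤q , bounded) = x≤q ∷ All.map (λ y≤x → ≤-trans y≤x x≤q) (parts≤ p bounded)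

length≤sum : ∀ {m} p → BoundedPartition m p → length p ≤ sum p
length≤sum []      _                   = z≤n
length≤sum (x ∷ p) (1≤x , _ , bounded) = +-mono-≤ 1≤x (length≤sum p bounded)

bounded1⇒length≡sum : ∀ p → BoundedPartition 1 p → length p ≡ sum p
bounded1⇒length≡sum []                _                 = refl
bounded1⇒length≡sum (1 ∷ p)           (_ , _ , bounded) = cong suc (bounded1⇒length≡sum p bounded)
bounded1⇒length≡sum (suc (suc _) ∷ _) (_ , s≤s () , _)

length≡sum⇒noEvenParts : ∀ {m} p → BoundedPartition m p → length p ≡ sum p → noEvenParts p ≡ true
length≡sum⇒noEvenParts []                _                 _  = refl
length≡sum⇒noEvenParts (1 ∷ p)           (_ , _ , bounded) eq = length≡sum⇒noEvenParts p bounded (suc-injective eq)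
length≡sum⇒noEvenParts (suc (suc x) ∷ p) (_ , _ , bounded) eq =
  ⊥-elim (<⇒≱ (subst (sum p <_) (sym (suc-injective eq)) (s≤s (m≤n+m (sum p) x))) (length≤sum p bounded))

length+1≢sum : ∀ {m} p → BoundedPartition m p → noEvenParts p ≡ true → length p + 1 ≢ sum p
length+1≢sum []                      _                 _   ()
length+1≢sum (1 ∷ p)                 (_ , _ , bounded) odd eq = length+1≢sum p bounded odd (suc-injective eq)
length+1≢sum (2 ∷ p)                 _                 ()  _
length+1≢sum (suc (suc (suc x)) ∷ p) (_ , _ , bounded) _   eq =
  <⇒≱ (subst (sum p <_) (sym length≡) (s≤s (m≤n+m (sum p) x))) (length≤sum p bounded)
  where
  length≡ : length p ≡ suc (x + sum p)
  length≡ = suc-injective (trans (+-comm 1 (length p)) (suc-injective eq))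

count-all-ones≡1 : ∀ fuel m r → 1 ≤ m → r ≤ fuel →
  ∑[ p ∈ boundedPartitions fuel m r ] 𝟙 (does (length p ≟ r)) ≡ 1
count-all-ones≡1 _          m zero    _   _             = refl
count-all-ones≡1 (suc fuel) m (suc r) 1≤m (s≤s r≤fuel) = begin
  ∑[ p ∈ boundedPartitions (suc fuel) m (suc r) ] hasLength (suc r) p
    ≡⟨ ∑-boundedPartitions (hasLength (suc r)) fuel m r ⟩
  ∑[ j ∈ upTo (suc r) ] byFirst j
    ≡⟨ ∑-upTo-suc byFirst r ⟩
  byFirst 0 + ∑[ j ∈ upTo r ] byFirst (suc j)
    ≡⟨ cong₂ _+_ firstPartOne (∑-zero (upTo r) firstPartLarger) ⟩
  1 + 0 ∎
  where
  open ≡-Reasoning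
  hasLength : ℕ → Partition → ℕ
  hasLength n p = 𝟙 (does (length p ≟ n))
  byFirst : ℕ → ℕ
  byFirst j = if does (suc j ≤? m)
    then ∑[ rest ∈ boundedPartitions fuel (suc j) (r ∸ j) ] hasLength (suc r) (suc j ∷ rest) else 0
  firstPartOne : byFirst 0 ≡ 1
  firstPartOne = begin
    byFirst 0
      ≡⟨ cong (λ b → if b then ∑[ rest ∈ boundedPartitions fuel 1 r ] hasLength (suc r) (1 ∷ rest) else 0)
              (dec-true (1 ≤? m) 1≤m) ⟩
    ∑[ rest ∈ boundedPartitions fuel 1 r ] hasLength (suc r) (1 ∷ rest)
      ≡⟨ ∑-cong (boundedPartitions fuel 1 r)
                (λ {rest} _ → cong 𝟙 (does-⇔ (mk⇔ suc-injective (cong suc)) (suc (length rest) ≟ suc r) (length rest ≟ r))) ⟩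
    ∑[ rest ∈ boundedPartitions fuel 1 r ] hasLength r rest
      ≡⟨ count-all-ones≡1 fuel 1 r ≤-refl r≤fuel ⟩
    1 ∎
  firstPartLarger : ∀ {j} → j ∈ upTo r → byFirst (suc j) ≡ 0
  firstPartLarger {j} j∈ = if≡0 (does (suc (suc j) ≤? m)) λ _ →
    trans (∑-cong-boundedPartitions fuel (suc (suc j)) (r ∸ suc j) tooFewParts)
          (∑-zero (boundedPartitions fuel (suc (suc j)) (r ∸ suc j)) (λ _ → refl))
    where
    tooFewParts : ∀ {rest} → BoundedPartition (suc (suc j)) rest → sum rest ≡ r ∸ suc j →
                  hasLength (suc r) (suc (suc j) ∷ rest) ≡ 0
    tooFewParts {rest} bounded sum≡ =
      cong 𝟙 (dec-false (suc (length rest) ≟ suc r) (λ eq → <⇒≢ length<r (suc-injective eq)))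
      where
      length<r : length rest < r
      length<r = ≤-<-trans (≤-trans (length≤sum rest bounded) (≤-reflexive sum≡)) (∸-monoʳ-< z<s (∈-upTo⁻ j∈))

colLength-∷ : ∀ {q j} rest → j < q → colLength (q ∷ rest) j ≡ suc (colLength rest j)
colLength-∷ {j = j} rest j<q = cong length (filter-accept (λ r → j <? r) j<q)

colLength≤length : ∀ p j → colLength p j ≤ length p
colLength≤length p j = length-filter (λ r → j <? r) p

colLength-zero : ∀ {m} p → BoundedPartition m p → colLength p 0 ≡ length p
colLength-zero []      _                   = refl
colLength-zero (x ∷ p) (1≤x , _ , bounded) = trans (colLength-∷ p 1≤x) (cong suc (colLength-zero p bounded))

colLength-one+length≤sum : ∀ {m} p → BoundedPartition m p → colLength p 1 + length p ≤ sum p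
colLength-one+length≤sum []                _                 = z≤n
colLength-one+length≤sum (1 ∷ p)           (_ , _ , bounded) =
  subst (_≤ suc (sum p)) (sym (+-suc (colLength p 1) (length p))) (s≤s (colLength-one+length≤sum p bounded))
colLength-one+length≤sum (suc (suc x) ∷ p) (_ , _ , bounded) =
  subst (_≤ suc (suc x) + sum p) (sym (+-suc (suc (colLength p 1)) (length p)))
        (s≤s (s≤s (≤-trans (colLength-one+length≤sum p bounded) (m≤n+m (sum p) x))))

colLength-one≡sum⇔sum≡0 : ∀ {m} p → BoundedPartition m p → colLength p 1 ≡ sum p ⇔ sum p ≡ 0
colLength-one≡sum⇔sum≡0 []      _                    = mk⇔ (λ _ → refl) (λ _ → refl)
colLength-one≡sum⇔sum≡0 (x ∷ p) bounded@(1≤x , _ , _) = mk⇔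
  (λ eq → ⊥-elim (<⇒≢ (m+1+n≤o⇒m<o _ (colLength-one+length≤sum (x ∷ p) bounded)) eq))
  (λ eq → ⊥-elim (<⇒≢ (≤-trans 1≤x (m≤m+n x (sum p))) (sym eq)))

firstRowHook : ℕ → Partition → ℕ → ℕ
firstRowHook q rest j = (q ∸ suc j) + colLength rest j + 1

firstRowHook+j≤ : ∀ {m} q rest {j} → BoundedPartition m rest → j < q → firstRowHook q rest j + j ≤ q + sum rest
firstRowHook+j≤ q rest {j} bounded j<q = begin
  (q ∸ suc j) + c + 1 + j ≡⟨ rearrange (q ∸ suc j) c j ⟩
  (q ∸ suc j) + suc j + c ≡⟨ cong (_+ c) (m∸n+n≡m j<q) ⟩
  q + c                   ≤⟨ +-monoʳ-≤ q (≤-trans (colLength≤length rest j) (length≤sum rest bounded)) ⟩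
  q + sum rest            ∎
  where
  open ≤-Reasoning
  c = colLength rest j
  rearrange : ∀ a c j → a + c + 1 + j ≡ a + suc j + c
  rearrange = solve-∀

countRows-∷ : ∀ k q rest i rows → All (_≤ q) rows → countRows (q ∷ rest) k (suc i) rows ≡ countRows rest k i rows
countRows-∷ k q rest i []         []             = refl
countRows-∷ k q rest i (l ∷ rows) (l≤q ∷ rows≤q) = cong₂ _+_ sameRow (countRows-∷ k q rest (suc i) rows rows≤q)
  where
  sameRow : length (filter (λ j → hookLength (q ∷ rest) (suc i) l j ≟ k) (upTo l))
          ≡ length (filter (λ j → hookLength rest i l j ≟ k) (upTo l))
  sameRow = trans (length-filter≡∑ (λ j → hookLength (q ∷ rest) (suc i) l j ≟ k) (upTo l))
    (trans (∑-cong (upTo l) (λ {j} j∈ → cong (λ c → 𝟙 (does ((l ∸ suc j) + (c ∸ suc (suc i)) + 1 ≟ k)))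
                                              (colLength-∷ rest (≤-trans (∈-upTo⁻ j∈) l≤q))))
           (sym (length-filter≡∑ (λ j → hookLength rest i l j ≟ k) (upTo l))))

hookCount-∷ : ∀ k q rest → BoundedPartition q rest →
  hookCount k (q ∷ rest) ≡ ∑[ j ∈ upTo q ] 𝟙 (does (firstRowHook q rest j ≟ k)) + hookCount k rest
hookCount-∷ k q rest bounded = cong₂ _+_ firstRow (countRows-∷ k q rest 0 rest (parts≤ rest bounded))
  where
  firstRow = trans (length-filter≡∑ (λ j → hookLength (q ∷ rest) 0 q j ≟ k) (upTo q))
    (∑-cong (upTo q) (λ {j} j∈ → cong (λ c → 𝟙 (does ((q ∸ suc j) + (c ∸ 1) + 1 ≟ k)))
                                      (colLength-∷ rest (∈-upTo⁻ j∈))))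

sum<⇒hookCount≡0 : ∀ {m} k p → BoundedPartition m p → sum p < k → hookCount k p ≡ 0
sum<⇒hookCount≡0 k []         _                 _     = refl
sum<⇒hookCount≡0 k (q ∷ rest) (_ , _ , bounded) sum<k = begin
  hookCount k (q ∷ rest)
    ≡⟨ hookCount-∷ k q rest bounded ⟩
  ∑[ j ∈ upTo q ] 𝟙 (does (firstRowHook q rest j ≟ k)) + hookCount k rest
    ≡⟨ cong₂ _+_ (∑-zero (upTo q) firstRowShort) (sum<⇒hookCount≡0 k rest bounded (≤-<-trans (m≤n+m (sum rest) q) sum<k)) ⟩
  0 ∎
  where
  open ≡-Reasoning
  firstRowShort : ∀ {j} → j ∈ upTo q → 𝟙 (does (firstRowHook q rest j ≟ k)) ≡ 0
  firstRowShort {j} j∈ = cong 𝟙 (dec-false (firstRowHook q rest j ≟ k)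
    (<⇒≢ (≤-<-trans (m+n≤o⇒m≤o _ (firstRowHook+j≤ q rest bounded (∈-upTo⁻ j∈))) sum<k)))

hookCount-sum : ∀ q rest → BoundedPartition (suc q) rest →
  hookCount (sum (suc q ∷ rest)) (suc q ∷ rest) ≡ 𝟙 (does (length rest ≟ sum rest))
hookCount-sum q rest bounded = begin
  hookCount n (suc q ∷ rest)
    ≡⟨ hookCount-∷ n (suc q) rest bounded ⟩
  ∑[ j ∈ upTo (suc q) ] hookIsN j + hookCount n rest
    ≡⟨ cong₂ _+_ (∑-upTo-suc hookIsN q) (sum<⇒hookCount≡0 n rest bounded (s≤s (m≤n+m (sum rest) q))) ⟩
  hookIsN 0 + ∑[ j ∈ upTo q ] hookIsN (suc j) + 0
    ≡⟨ cong₂ (λ a b → a + b + 0) corner (∑-zero (upTo q) laterColumns) ⟩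
  𝟙 (does (length rest ≟ sum rest)) + 0 + 0
    ≡⟨ trans (+-identityʳ _) (+-identityʳ _) ⟩
  𝟙 (does (length rest ≟ sum rest)) ∎
  where
  open ≡-Reasoning
  n = sum (suc q ∷ rest)
  hookIsN : ℕ → ℕ
  hookIsN j = 𝟙 (does (firstRowHook (suc q) rest j ≟ n))
  corner : hookIsN 0 ≡ 𝟙 (does (length rest ≟ sum rest))
  corner = trans (cong (λ c → 𝟙 (does (q + c + 1 ≟ n))) (colLength-zero rest bounded))
                 (cong 𝟙 (does-⇔ (m+n+1≡1+m+o⇔n≡o q (length rest) (sum rest)) (q + length rest + 1 ≟ n) (length rest ≟ sum rest)))
  laterColumns : ∀ {j} → j ∈ upTo q → hookIsN (suc j) ≡ 0
  laterColumns {j} j∈ = cong 𝟙 (dec-false (firstRowHook (suc q) rest (suc j) ≟ n)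
    (<⇒≢ (m+1+n≤o⇒m<o _ (firstRowHook+j≤ (suc q) rest bounded (s≤s (∈-upTo⁻ j∈))))))

hookCount-sum∸1 : ∀ q rest → BoundedPartition (suc (suc q)) rest → noEvenParts rest ≡ true →
  hookCount (suc q + sum rest) (suc (suc q) ∷ rest) ≡ 𝟙 (does (sum rest ≟ 0))
hookCount-sum∸1 q rest bounded regular = begin
  hookCount n (suc (suc q) ∷ rest)
    ≡⟨ hookCount-∷ n (suc (suc q)) rest bounded ⟩
  ∑[ j ∈ upTo (suc (suc q)) ] hookIsN j + hookCount n rest
    ≡⟨ cong₂ _+_ (∑-upTo-suc hookIsN (suc q)) (sum<⇒hookCount≡0 n rest bounded (s≤s (m≤n+m (sum rest) q))) ⟩
  hookIsN 0 + ∑[ j ∈ upTo (suc q) ] hookIsN (suc j) + 0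
    ≡⟨ cong (λ s → hookIsN 0 + s + 0) (∑-upTo-suc (λ j → hookIsN (suc j)) q) ⟩
  hookIsN 0 + (hookIsN 1 + ∑[ j ∈ upTo q ] hookIsN (suc (suc j))) + 0
    ≡⟨ cong₂ (λ a b → a + b + 0) corner (cong₂ _+_ secondBox (∑-zero (upTo q) laterColumns)) ⟩
  0 + (𝟙 (does (sum rest ≟ 0)) + 0) + 0
    ≡⟨ trans (+-identityʳ _) (+-identityʳ _) ⟩
  𝟙 (does (sum rest ≟ 0)) ∎
  where
  open ≡-Reasoning
  n = suc q + sum rest
  hookIsN : ℕ → ℕ
  hookIsN j = 𝟙 (does (firstRowHook (suc (suc q)) rest j ≟ n))
  -- The corner hook is n only if sum rest = length rest + 1, impossible for odd parts.
  corner : hookIsN 0 ≡ 0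
  corner = cong 𝟙 (dec-false (firstRowHook (suc (suc q)) rest 0 ≟ n) (λ eq →
    length+1≢sum rest bounded regular
      (trans (cong (_+ 1) (sym (colLength-zero rest bounded)))
             (+-cancelˡ-≡ (suc q) _ _ (trans (sym (+-assoc (suc q) _ 1)) eq)))))
  secondBox : hookIsN 1 ≡ 𝟙 (does (sum rest ≟ 0))
  secondBox = cong 𝟙 (trans
    (does-⇔ (m+n+1≡1+m+o⇔n≡o q (colLength rest 1) (sum rest)) (firstRowHook (suc (suc q)) rest 1 ≟ n) (colLength rest 1 ≟ sum rest))
    (does-⇔ (colLength-one≡sum⇔sum≡0 rest bounded) (colLength rest 1 ≟ sum rest) (sum rest ≟ 0)))
  laterColumns : ∀ {j} → j ∈ upTo q → hookIsN (suc (suc j)) ≡ 0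
  laterColumns {j} j∈ = cong 𝟙 (dec-false (hook ≟ n) (<⇒≢ (m+1+n≤o⇒m<o hook (≤-pred
    (subst (_≤ suc (suc q) + sum rest) (+-suc hook (suc j))
           (firstRowHook+j≤ (suc (suc q)) rest bounded (s≤s (s≤s (∈-upTo⁻ j∈)))))))))
    where hook = firstRowHook (suc (suc q)) rest (suc (suc j))

hookCount-column : ∀ p → BoundedPartition 1 p → hookCount (sum (1 ∷ p)) (1 ∷ 1 ∷ p) ≡ 1
hookCount-column p bounded = begin
  hookCount n (1 ∷ 1 ∷ p)
    ≡⟨ hookCount-∷ n 1 (1 ∷ p) (≤-refl , ≤-refl , bounded) ⟩
  𝟙 (does (firstRowHook 1 (1 ∷ p) 0 ≟ n)) + 0 + hookCount n (1 ∷ p)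
    ≡⟨ cong₂ (λ a b → a + 0 + b) corner (hookCount-sum 0 p bounded) ⟩
  𝟙 (does (length p ≟ sum p))
    ≡⟨ cong 𝟙 (dec-true (length p ≟ sum p) (bounded1⇒length≡sum p bounded)) ⟩
  1 ∎
  where
  open ≡-Reasoning
  n = sum (1 ∷ p)
  corner : 𝟙 (does (firstRowHook 1 (1 ∷ p) 0 ≟ n)) ≡ 0
  corner = cong 𝟙 (dec-false (firstRowHook 1 (1 ∷ p) 0 ≟ n) (λ eq → m+1+n≢m n (trans (cong (_+ 1) (sym column≡)) eq)))
    where
    column≡ : colLength (1 ∷ p) 0 ≡ n
    column≡ = trans (colLength-zero (1 ∷ p) (≤-refl , ≤-refl , bounded)) (cong suc (bounded1⇒length≡sum p bounded))

-- The parity test of noEvenParts, so that noEvenParts (q ∷ p) unfolds to isOdd q ∧ noEvenParts p.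
isOdd : ℕ → Bool
isOdd q = ⌊ q % 2 ≟ 1 ⌋

regularHookCount : ℕ → Partition → ℕ
regularHookCount k p = if noEvenParts p then hookCount k p else 0

b2-byFirstPart : ∀ k n → b2 k (suc n) ≡
  ∑[ j ∈ upTo (suc n) ] ∑[ rest ∈ boundedPartitions n (suc j) (n ∸ j) ] regularHookCount k (suc j ∷ rest)
b2-byFirstPart k n = begin
  b2 k (suc n)
    ≡⟨ ∑-filter (λ p → T? (noEvenParts p)) (hookCount k) (partitions (suc n)) ⟩
  ∑[ p ∈ partitions (suc n) ] regularHookCount k p
    ≡⟨ ∑-boundedPartitions (regularHookCount k) n (suc n) n ⟩
  ∑[ j ∈ upTo (suc n) ] (if does (suc j ≤? suc n) then byFirst j else 0)
    ≡⟨ ∑-cong (upTo (suc n)) (λ {j} j∈ → cong (λ b → if b then byFirst j else 0)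
                                             (dec-true (suc j ≤? suc n) (∈-upTo⁻ j∈))) ⟩
  ∑[ j ∈ upTo (suc n) ] byFirst j ∎
  where
  open ≡-Reasoning
  byFirst : ℕ → ℕ
  byFirst j = ∑[ rest ∈ boundedPartitions n (suc j) (n ∸ j) ] regularHookCount k (suc j ∷ rest)

sum-∷≡ : ∀ {j n} rest → j ≤ n → sum rest ≡ n ∸ j → sum (suc j ∷ rest) ≡ suc n
sum-∷≡ {j} rest j≤n sum≡ = cong suc (trans (cong (j +_) sum≡) (m+[n∸m]≡n j≤n))

regularHookCount-size : ∀ {j n} rest → BoundedPartition (suc j) rest → j ≤ n → sum rest ≡ n ∸ j →
  regularHookCount (suc n) (suc j ∷ rest) ≡ (if isOdd (suc j) then 𝟙 (does (length rest ≟ n ∸ j)) else 0)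
regularHookCount-size {j} {n} rest bounded j≤n sum≡ = begin
  (if isOdd (suc j) ∧ noEvenParts rest then hookCount (suc n) (suc j ∷ rest) else 0)
    ≡⟨ cong (λ N → if isOdd (suc j) ∧ noEvenParts rest then hookCount N (suc j ∷ rest) else 0)
            (sum-∷≡ rest j≤n sum≡) ⟨
  (if isOdd (suc j) ∧ noEvenParts rest then hookCount (sum (suc j ∷ rest)) (suc j ∷ rest) else 0)
    ≡⟨ cong (λ c → if isOdd (suc j) ∧ noEvenParts rest then c else 0) (hookCount-sum j rest bounded) ⟩
  (if isOdd (suc j) ∧ noEvenParts rest then 𝟙 (does (length rest ≟ sum rest)) else 0)
    ≡⟨ cong (λ s → if isOdd (suc j) ∧ noEvenParts rest then 𝟙 (does (length rest ≟ s)) else 0) sum≡ ⟩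
  (if isOdd (suc j) ∧ noEvenParts rest then 𝟙 (does (length rest ≟ n ∸ j)) else 0)
    ≡⟨ if-∧-redundant (isOdd (suc j)) (noEvenParts rest) (length rest ≟ n ∸ j)
                      (λ length≡ → length≡sum⇒noEvenParts rest bounded (trans length≡ (sym sum≡))) ⟩
  (if isOdd (suc j) then 𝟙 (does (length rest ≟ n ∸ j)) else 0) ∎
  where open ≡-Reasoning

regularHookCount-column : ∀ {n} rest → BoundedPartition 1 rest → sum rest ≡ suc n →
  regularHookCount (suc n) (1 ∷ rest) ≡ 𝟙 (does (length rest ≟ suc n))
regularHookCount-column {n} (1 ∷ p) (_ , _ , bounded) sum≡ = begin
  (if noEvenParts p then hookCount (suc n) (1 ∷ 1 ∷ p) else 0)
    ≡⟨ cong (λ b → if b then hookCount (suc n) (1 ∷ 1 ∷ p) else 0) (length≡sum⇒noEvenParts p bounded length≡) ⟩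
  hookCount (suc n) (1 ∷ 1 ∷ p)
    ≡⟨ cong (λ N → hookCount N (1 ∷ 1 ∷ p)) sum≡ ⟨
  hookCount (sum (1 ∷ p)) (1 ∷ 1 ∷ p)
    ≡⟨ hookCount-column p bounded ⟩
  1
    ≡⟨ cong 𝟙 (dec-true (suc (length p) ≟ suc n) (trans (cong suc length≡) sum≡)) ⟨
  𝟙 (does (suc (length p) ≟ suc n)) ∎
  where
  open ≡-Reasoning
  length≡ : length p ≡ sum p
  length≡ = bounded1⇒length≡sum p bounded
regularHookCount-column []                _                ()
regularHookCount-column (zero ∷ _)        (() , _)         _
regularHookCount-column (suc (suc _) ∷ _) (_ , s≤s () , _) _

regularHookCount-size∸1 : ∀ {j n} rest → BoundedPartition (suc (suc j)) rest → j < n → sum rest ≡ n ∸ j →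
  regularHookCount (suc n) (suc (suc j) ∷ rest) ≡ 0
regularHookCount-size∸1 {j} {n} rest bounded j<n sum≡ = if≡0 (isOdd (suc (suc j)) ∧ noEvenParts rest) λ regular → begin
  hookCount (suc n) (suc (suc j) ∷ rest)
    ≡⟨ cong (λ N → hookCount N (suc (suc j) ∷ rest)) (sum-∷≡ rest (<⇒≤ j<n) sum≡) ⟨
  hookCount (suc j + sum rest) (suc (suc j) ∷ rest)
    ≡⟨ hookCount-sum∸1 j rest bounded (∧-conicalʳ _ _ regular) ⟩
  𝟙 (does (sum rest ≟ 0))
    ≡⟨ cong 𝟙 (dec-false (sum rest ≟ 0) (λ sum≡0 → <⇒≢ (m<n⇒0<n∸m j<n) (trans (sym sum≡0) sum≡))) ⟩
  0 ∎
  where open ≡-Reasoning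

oddsUpTo : ℕ → ℕ
oddsUpTo n = ∑[ j ∈ upTo n ] 𝟙 (isOdd (suc j))

b2-diagonal : ∀ n → b2 n n ≡ oddsUpTo n
b2-diagonal zero    = refl
b2-diagonal (suc n) = trans (b2-byFirstPart (suc n) n) (∑-cong (upTo (suc n)) (λ j∈ → byFirst (∈-upTo⁻ j∈)))
  where
  open ≡-Reasoning
  byFirst : ∀ {j} → j < suc n →
    ∑[ rest ∈ boundedPartitions n (suc j) (n ∸ j) ] regularHookCount (suc n) (suc j ∷ rest) ≡ 𝟙 (isOdd (suc j))
  byFirst {j} (s≤s j≤n) = begin
    ∑[ rest ∈ rests ] regularHookCount (suc n) (suc j ∷ rest)
      ≡⟨ ∑-cong-boundedPartitions n (suc j) (n ∸ j) (λ {rest} bounded → regularHookCount-size rest bounded j≤n) ⟩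
    ∑[ rest ∈ rests ] (if isOdd (suc j) then 𝟙 (does (length rest ≟ n ∸ j)) else 0)
      ≡⟨ ∑-if (isOdd (suc j)) (λ rest → 𝟙 (does (length rest ≟ n ∸ j))) rests ⟩
    (if isOdd (suc j) then ∑[ rest ∈ rests ] 𝟙 (does (length rest ≟ n ∸ j)) else 0)
      ≡⟨ cong (λ c → if isOdd (suc j) then c else 0) (count-all-ones≡1 n (suc j) (n ∸ j) (s≤s z≤n) (m∸n≤m n j)) ⟩
    𝟙 (isOdd (suc j)) ∎
    where rests = boundedPartitions n (suc j) (n ∸ j)

b2-subdiagonal : ∀ k → 1 ≤ k → b2 k (k + 1) ≡ 1 + 𝟙 (isOdd (k + 1))
b2-subdiagonal (suc n) _ rewrite +-comm n 1 = begin
  b2 (suc n) (suc (suc n))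
    ≡⟨ b2-byFirstPart (suc n) (suc n) ⟩
  ∑[ j ∈ upTo (suc (suc n)) ] byFirst j
    ≡⟨ ∑-upTo-suc byFirst (suc n) ⟩
  byFirst 0 + ∑[ j ∈ upTo (suc n) ] byFirst (suc j)
    ≡⟨ cong (byFirst 0 +_) (∑-upTo-∷ʳ (λ j → byFirst (suc j)) n) ⟩
  byFirst 0 + (∑[ j ∈ upTo n ] byFirst (suc j) + byFirst (suc n))
    ≡⟨ cong₂ _+_ firstPartOne (cong₂ _+_ (∑-zero (upTo n) firstPartMiddle) firstPartWhole) ⟩
  1 + 𝟙 (isOdd (suc (suc n))) ∎
  where
  open ≡-Reasoning
  byFirst : ℕ → ℕ
  byFirst j = ∑[ rest ∈ boundedPartitions (suc n) (suc j) (suc n ∸ j) ] regularHookCount (suc n) (suc j ∷ rest)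

  firstPartOne : byFirst 0 ≡ 1
  firstPartOne = trans (∑-cong-boundedPartitions (suc n) 1 (suc n) (λ {rest} → regularHookCount-column rest))
                       (count-all-ones≡1 (suc n) 1 (suc n) ≤-refl ≤-refl)

  firstPartMiddle : ∀ {j} → j ∈ upTo n → byFirst (suc j) ≡ 0
  firstPartMiddle {j} j∈ =
    trans (∑-cong-boundedPartitions (suc n) (suc (suc j)) (n ∸ j)
             (λ {rest} bounded → regularHookCount-size∸1 rest bounded (∈-upTo⁻ j∈)))
          (∑-zero (boundedPartitions (suc n) (suc (suc j)) (n ∸ j)) (λ _ → refl))

  firstPartWhole : byFirst (suc n) ≡ 𝟙 (isOdd (suc (suc n)))
  firstPartWhole = begin
    byFirst (suc n)
      ≡⟨ cong (λ r → ∑[ rest ∈ boundedPartitions (suc n) (suc (suc n)) r ] regularHookCount (suc n) (suc (suc n) ∷ rest))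
              (n∸n≡0 n) ⟩
    (if isOdd (suc (suc n)) ∧ true then hookCount (suc n) (suc (suc n) ∷ []) else 0) + 0
      ≡⟨ +-identityʳ _ ⟩
    (if isOdd (suc (suc n)) ∧ true then hookCount (suc n) (suc (suc n) ∷ []) else 0)
      ≡⟨ cong₂ (λ b h → if b then h else 0) (∧-identityʳ (isOdd (suc (suc n)))) singleRow ⟩
    𝟙 (isOdd (suc (suc n))) ∎
    where
    singleRow : hookCount (suc n) (suc (suc n) ∷ []) ≡ 1
    singleRow = subst (λ N → hookCount N (suc (suc n) ∷ []) ≡ 1) (+-identityʳ (suc n)) (hookCount-sum∸1 n [] tt refl)

isOdd-even : ∀ m → isOdd (2 * m) ≡ false
isOdd-even m = cong (λ r → ⌊ r ≟ 1 ⌋) (trans (cong (_% 2) (*-comm 2 m)) (m*n%n≡0 m 2))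

isOdd-odd : ∀ m → isOdd (2 * m + 1) ≡ true
isOdd-odd m = cong (λ r → ⌊ r ≟ 1 ⌋)
  (trans (cong (_% 2) (trans (+-comm (2 * m) 1) (cong suc (*-comm 2 m)))) ([m+kn]%n≡m%n 1 m 2))

2[1+m]≡2m+1+1 : ∀ m → 2 * suc m ≡ 2 * m + 1 + 1
2[1+m]≡2m+1+1 = solve-∀

oddsUpTo-even : ∀ m → oddsUpTo (2 * m) ≡ m
oddsUpTo-odd  : ∀ m → oddsUpTo (2 * m + 1) ≡ m + 1

oddsUpTo-odd m = begin
  oddsUpTo (2 * m + 1)                        ≡⟨ cong oddsUpTo (+-comm (2 * m) 1) ⟩
  oddsUpTo (suc (2 * m))                      ≡⟨ ∑-upTo-∷ʳ (λ j → 𝟙 (isOdd (suc j))) (2 * m) ⟩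
  oddsUpTo (2 * m) + 𝟙 (isOdd (suc (2 * m))) ≡⟨ cong₂ _+_ (oddsUpTo-even m) (cong 𝟙 odd) ⟩
  m + 1                                       ∎
  where
  open ≡-Reasoning
  odd : isOdd (suc (2 * m)) ≡ true
  odd = trans (cong isOdd (+-comm 1 (2 * m))) (isOdd-odd m)

oddsUpTo-even zero    = refl
oddsUpTo-even (suc m) = begin
  oddsUpTo (2 * suc m)                            ≡⟨ cong oddsUpTo (2[1+m]≡2m+1+1 m) ⟩
  oddsUpTo (2 * m + 1 + 1)                        ≡⟨ cong oddsUpTo (+-comm (2 * m + 1) 1) ⟩
  oddsUpTo (suc (2 * m + 1))                      ≡⟨ ∑-upTo-∷ʳ (λ j → 𝟙 (isOdd (suc j))) (2 * m + 1) ⟩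
  oddsUpTo (2 * m + 1) + 𝟙 (isOdd (suc (2 * m + 1))) ≡⟨ cong₂ _+_ (oddsUpTo-odd m) (cong 𝟙 even) ⟩
  m + 1 + 0                                       ≡⟨ trans (+-identityʳ (m + 1)) (+-comm m 1) ⟩
  suc m                                           ∎
  where
  open ≡-Reasoning
  even : isOdd (suc (2 * m + 1)) ≡ false
  even = trans (cong isOdd (trans (+-comm 1 (2 * m + 1)) (sym (2[1+m]≡2m+1+1 m)))) (isOdd-even (suc m))

b2-odd : ∀ m → b2 (2 * m + 1) (2 * m + 1) ≡ m + 1 × b2 (2 * m + 1) (2 * m + 1 + 1) ≡ 1
b2-odd m = trans (b2-diagonal k) (oddsUpTo-odd m) , (begin
  b2 k (k + 1)              ≡⟨ b2-subdiagonal k (m≤n+m 1 (2 * m)) ⟩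
  1 + 𝟙 (isOdd (k + 1))     ≡⟨ cong (λ n → 1 + 𝟙 (isOdd n)) (2[1+m]≡2m+1+1 m) ⟨
  1 + 𝟙 (isOdd (2 * suc m)) ≡⟨ cong (λ b → 1 + 𝟙 b) (isOdd-even (suc m)) ⟩
  1                         ∎)
  where
  open ≡-Reasoning
  k = 2 * m + 1

b2-even : ∀ m → b2 (2 * suc m) (2 * suc m) ≡ suc m × b2 (2 * suc m) (2 * suc m + 1) ≡ 2
b2-even m = trans (b2-diagonal (2 * suc m)) (oddsUpTo-even (suc m))
          , trans (b2-subdiagonal (2 * suc m) (s≤s z≤n)) (cong (λ b → 1 + 𝟙 b) (isOdd-odd (suc m)))

theorem1p6 : ∀ (k : ℕ) → 1 ≤ k →
    (∀ (m : ℕ) → k ≡ 2 * m + 1 → b2 k k ≡ m + 1 × b2 k (k + 1) ≡ 1) ×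
    (∀ (m : ℕ) → k ≡ 2 * m → b2 k k ≡ m × b2 k (k + 1) ≡ 2)
theorem1p6 k 1≤k =
    (λ m k≡2m+1 → subst (λ k → b2 k k ≡ m + 1 × b2 k (k + 1) ≡ 1) (sym k≡2m+1) (b2-odd m))
  , λ { zero    k≡0    → ⊥-elim (<⇒≢ 1≤k (sym k≡0))
      ; (suc m) k≡2+2m → subst (λ k → b2 k k ≡ suc m × b2 k (k + 1) ≡ 2) (sym k≡2+2m) (b2-even m) }
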